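{- Let $y=\tan x$, $z=\sec x$, $D=d/dx$, and $(yD)^0(f)=f$, $(yD)^{n+1}(f)=y\,D\big((yD)^n(f)\big)$. Define polynomials $R_n(y)$ and $T_n(y)$ by $(yD)^n(y)=R_n(y)$ and $(yD)^n(z)=z\,T_n(y)$ (equivalently $R_0(y)=y$, $R_{n+1}(y)=y(1+y^2)R_n'(y)$, $T_0(y)=1$, $T_{n+1}(y)=y^2T_n(y)+y(1+y^2)T_n'(y)$). Let $N_n(x)=\sum_{k=1}^nN(n,k)x^k$, where $N(n,k)$ are defined by $(yD)^n(z)=\sum_{k=1}^nN(n,k)y^{2k}z^{2n-2k+1}$. Then for $n\ge1$, $$R_n(y)=y^{2n+1}N_n\!\left(\frac{1+y^2}{y^2}\right)\quad\text{and}\quad T_n(y)=(1+y^2)^nN_n\!\left(\frac{y^2}{1+y^2}\right).$$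
   Context: The numbers $N(n,k)$ are determined by $N(1,1)=1$, $N(n,0)=0$, $N(n,k)=0$ for $k>n$, and $N(n+1,k)=2kN(n,k)+(2n-2k+3)N(n,k-1)$; e.g. $N_1(x)=x$, $N_2(x)=2x+x^2$, $N_3(x)=4x+10x^2+x^3$. -}

module Defs where

open import Data.Nat as ℕ using (ℕ; zero; suc)
open import Data.Integer as ℤ using (+_; +[1+_]; -[1+_])
open import Data.List using (List; []; _∷_)
open import Data.Rational using (ℚ; mkℚ; 0ℚ; 1ℚ; _+_; _*_; _/_; NonZero; Positive; NonNegative)
open import Data.Rational.Properties
  using (pos*pos⇒pos; neg*neg⇒pos; pos⇒nonZero; pos⇒nonNeg; pos+nonNeg⇒pos; nonNeg*nonNeg⇒nonNeg)

-- The numbers N(n,k), exactly as in the paper: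
-- N(1,1)=1, N(n,0)=0, N(n,k)=0 for k>n,
-- N(n+1,k) = 2k N(n,k) + (2n-2k+3) N(n,k-1)   (n ≥ 1).
-- (N(0,k) is not used; we set it to 0.)  Truncated subtraction is harmless:
-- 2n-2k+3 ≥ 1 whenever k ≤ n+1, and for k > n+1 both N(n,k), N(n,k-1) vanish.

N : ℕ → ℕ → ℕ
N zero _ = 0
N (suc zero) zero = 0
N (suc zero) (suc zero) = 1
N (suc zero) (suc (suc _)) = 0
N (suc (suc n)) zero = 0
N (suc (suc n)) (suc k) =
  2 ℕ.* suc k ℕ.* N (suc n) (suc k)
  ℕ.+ (2 ℕ.* suc n ℕ.+ 3 ℕ.∸ 2 ℕ.* suc k) ℕ.* N (suc n) k

infixr 8 _^_
_^_ : ℚ → ℕ → ℚ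
x ^ zero = 1ℚ
x ^ suc n = x * (x ^ n)

fromℕ : ℕ → ℚ
fromℕ c = + c / 1

sum1 : (ℕ → ℚ) → ℕ → ℚ
sum1 f zero = 0ℚ
sum1 f (suc m) = sum1 f m + f (suc m)

Npoly : ℕ → ℚ → ℚ
Npoly n x = sum1 (λ k → fromℕ (N n k) * x ^ k) n

-- Polynomials in y with natural-number coefficients, as coefficient
-- lists (lowest degree first).

Poly : Set
Poly = List ℕ

padd : Poly → Poly → Poly
padd [] q = q
padd (a ∷ p) [] = a ∷ p
padd (a ∷ p) (b ∷ q) = (a ℕ.+ b) ∷ padd p q

pscale : ℕ → Poly → Poly
pscale c [] = []
pscale c (a ∷ p) = (c ℕ.* a) ∷ pscale c p

pmul : Poly → Poly → Poly
pmul [] q = []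
pmul (a ∷ p) q = padd (pscale a q) (0 ∷ pmul p q)

derivFrom : ℕ → Poly → Poly
derivFrom k [] = []
derivFrom k (a ∷ p) = (k ℕ.* a) ∷ derivFrom (suc k) p

deriv : Poly → Poly
deriv [] = []
deriv (_ ∷ p) = derivFrom 1 p

eval : Poly → ℚ → ℚ
eval [] y = 0ℚ
eval (a ∷ p) y = fromℕ a + y * eval p y

y+y³ : Poly
y+y³ = 0 ∷ 1 ∷ 0 ∷ 1 ∷ []

y² : Poly
y² = 0 ∷ 0 ∷ 1 ∷ []

R : ℕ → Poly
R zero = 0 ∷ 1 ∷ []
R (suc n) = pmul y+y³ (deriv (R n))

T : ℕ → Poly
T zero = 1 ∷ []
T (suc n) = padd (pmul y² (T n)) (pmul y+y³ (deriv (T n)))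

sq-nonZero : (y : ℚ) → .{{NonZero y}} → NonZero (y * y)
sq-nonZero y@(mkℚ +[1+ _ ] _ _) = pos⇒nonZero (y * y) {{pos*pos⇒pos y y}}
sq-nonZero y@(mkℚ -[1+ _ ] _ _) = pos⇒nonZero (y * y) {{neg*neg⇒pos y y}}

sq-nonNeg : (y : ℚ) → NonNegative (y * y)
sq-nonNeg y@(mkℚ +[1+ _ ] _ _) = pos⇒nonNeg (y * y) {{pos*pos⇒pos y y}}
sq-nonNeg y@(mkℚ (+ zero) _ _) = nonNeg*nonNeg⇒nonNeg y y
sq-nonNeg y@(mkℚ -[1+ _ ] _ _) = pos⇒nonNeg (y * y) {{neg*neg⇒pos y y}}

onePlusSq-nonZero : (y : ℚ) → NonZero (1ℚ + y * y)
onePlusSq-nonZero y =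
  pos⇒nonZero (1ℚ + y * y) {{pos+nonNeg⇒pos 1ℚ (y * y) {{sq-nonNeg y}}}}

module Submission where

-- Put w = 1 + y².  The recursions R_{n+1} = y w R_n′ and T_{n+1} = y² T_n + y w T_n′
-- are linear operators on coefficient sequences: with the Euler operator θ = y d/dy
-- they are R_{n+1} = Dᴿ R_n with Dᴿ = w θ, and T_{n+1} = Dᵀ T_n with Dᵀ = y² + w θ.
-- On the basis yᵃ wᵇ a Leibniz computation gives
--   Dᴿ (yᵃ wᵇ) = a yᵃ wᵇ⁺¹ + 2b y^{a+2} wᵇ,
--   Dᵀ (yᵃ wᵇ) = (2b+1) y^{a+2} wᵇ + a yᵃ wᵇ⁺¹,
-- and the recurrence of N(n,k) is exactly what makes the closed forms
--   R_n = Σ_{k=1}^{n} N(n,k) y^{2(n-k)+1} wᵏ,   T_n = Σ_{k=1}^{n} N(n,k) y^{2k} w^{n-k}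
-- stable under these operators (a Pascal-type reindexing of the sum).  Evaluating at y ∈ ℚ and factoring out
-- y^{2n+1}, resp. wⁿ, using y² · (w/y²) = w and w · (y²/w) = y², gives the theorem.

open import Defs
open import Data.Nat as ℕ using (ℕ; _≤_)
open import Data.Product using (_×_; _,_)
open import Relation.Binary.PropositionalEquality
  using (_≡_; _≗_; refl; sym; trans; cong; cong₂; module ≡-Reasoning)
open import Function using (id; _∘_)

module Coefficients where

  open import Data.Nat using (zero; suc; _+_; _*_; _∸_; _<_; z≤n; s≤s; _≤?_)
  open import Data.Nat.Properties
  open import Data.Nat.Tactic.RingSolver using (solve-∀)
  open import Data.List using ([]; _∷_)
  open import Relation.Nullary using (yes; no)
  open import Relation.Binary.PropositionalEquality using (_→-setoid_)
  import Relation.Binary.Reasoning.Setoid as SetoidReasoning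
  import Algebra.Properties.CommutativeSemigroup as CommSemigroupProperties

  module +-Props = CommSemigroupProperties +-commutativeSemigroup
  module *-Props = CommSemigroupProperties *-commutativeSemigroup

  Coeffs : Set
  Coeffs = ℕ → ℕ

  coeff : Poly → Coeffs
  coeff []      i       = 0
  coeff (a ∷ p) zero    = a
  coeff (a ∷ p) (suc i) = coeff p i

  module ≗-Reasoning = SetoidReasoning (ℕ →-setoid ℕ)

  infixl 6 _⊕_
  infixr 7 _⊙_

  _⊕_ : Coeffs → Coeffs → Coeffs
  (f ⊕ g) i = f i + g i

  _⊙_ : ℕ → Coeffs → Coeffs
  (c ⊙ f) i = c * f i

  ⊕-cong : ∀ {f f′ g g′} → f ≗ f′ → g ≗ g′ → f ⊕ g ≗ f′ ⊕ g′
  ⊕-cong e e′ i = cong₂ _+_ (e i) (e′ i)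

  ⊙-cong : ∀ c {f g} → f ≗ g → c ⊙ f ≗ c ⊙ g
  ⊙-cong c e i = cong (c *_) (e i)

  y·_ : Coeffs → Coeffs
  (y· f) zero    = 0
  (y· f) (suc i) = f i

  y²·_ : Coeffs → Coeffs
  y²· f = y· (y· f)

  w·_ : Coeffs → Coeffs
  w· f = f ⊕ y²· f

  -- The Euler operator θ = y d/dy multiplies the coefficient of yⁱ by i.
  θ : Coeffs → Coeffs
  θ f i = i * f i

  -- The operators of the two recursions, since y (1+y²) p′ = (1+y²) θ p.
  Dᴿ : Coeffs → Coeffs
  Dᴿ f = w· θ f

  Dᵀ : Coeffs → Coeffs
  Dᵀ f = y²· f ⊕ Dᴿ f

  record Linear (L : Coeffs → Coeffs) : Set where
    field
      resp        : ∀ {f g} → f ≗ g → L f ≗ L g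
      additive    : ∀ f g → L (f ⊕ g) ≗ L f ⊕ L g
      homogeneous : ∀ c f → L (c ⊙ f) ≗ c ⊙ L f

  linear-comb : ∀ {L} → Linear L → ∀ c f d g →
    L (c ⊙ f ⊕ d ⊙ g) ≗ c ⊙ L f ⊕ d ⊙ L g
  linear-comb linL c f d g i = trans (L.additive (c ⊙ f) (d ⊙ g) i)
    (cong₂ _+_ (L.homogeneous c f i) (L.homogeneous d g i))
    where module L = Linear linL

  linear-id : Linear id
  linear-id = record
    { resp = id ; additive = λ _ _ _ → refl ; homogeneous = λ _ _ _ → refl }

  linear-∘ : ∀ {L M} → Linear L → Linear M → Linear (λ f → L (M f))
  linear-∘ {L} {M} linL linM = record
    { resp        = λ e → L.resp (M.resp e)
    ; additive    = λ f g i →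
        trans (L.resp (M.additive f g) i) (L.additive (M f) (M g) i)
    ; homogeneous = λ c f i →
        trans (L.resp (M.homogeneous c f) i) (L.homogeneous c (M f) i)
    }
    where
    module L = Linear linL
    module M = Linear linM

  linear-⊕ : ∀ {L M} → Linear L → Linear M → Linear (λ f → L f ⊕ M f)
  linear-⊕ {L} {M} linL linM = record
    { resp        = λ e i → cong₂ _+_ (L.resp e i) (M.resp e i)
    ; additive    = λ f g i →
        trans (cong₂ _+_ (L.additive f g i) (M.additive f g i))
              (+-Props.interchange (L f i) (L g i) (M f i) (M g i))
    ; homogeneous = λ c f i →
        trans (cong₂ _+_ (L.homogeneous c f i) (M.homogeneous c f i))
              (sym (*-distribˡ-+ c (L f i) (M f i)))
    }
    where
    module L = Linear linL
    module M = Linear linM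

  linear-y· : Linear y·_
  linear-y· = record { resp = resp ; additive = additive ; homogeneous = homogeneous }
    where
    resp : ∀ {f g} → f ≗ g → y· f ≗ y· g
    resp e zero    = refl
    resp e (suc i) = e i
    additive : ∀ f g → y· (f ⊕ g) ≗ y· f ⊕ y· g
    additive f g zero    = refl
    additive f g (suc i) = refl
    homogeneous : ∀ c f → y· (c ⊙ f) ≗ c ⊙ y· f
    homogeneous c f zero    = sym (*-zeroʳ c)
    homogeneous c f (suc i) = refl

  linear-θ : Linear θ
  linear-θ = record
    { resp        = λ e i → cong (i *_) (e i)
    ; additive    = λ f g i → *-distribˡ-+ i (f i) (g i)
    ; homogeneous = λ c f i → *-Props.x∙yz≈y∙xz i c (f i)
    }

  linear-y²· : Linear y²·_
  linear-y²· = linear-∘ linear-y· linear-y·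

  linear-w· : Linear w·_
  linear-w· = linear-⊕ linear-id linear-y²·

  linear-Dᴿ : Linear Dᴿ
  linear-Dᴿ = linear-∘ linear-w· linear-θ

  linear-Dᵀ : Linear Dᵀ
  linear-Dᵀ = linear-⊕ linear-y²· linear-Dᴿ

  sumℕ : (ℕ → ℕ) → ℕ → ℕ
  sumℕ g zero    = 0
  sumℕ g (suc m) = sumℕ g m + g (suc m)

  Σᶜ : (ℕ → Coeffs) → ℕ → Coeffs
  Σᶜ g m i = sumℕ (λ k → g k i) m

  sumℕ-cong : ∀ {g h} m → (∀ k → k ≤ m → g k ≡ h k) → sumℕ g m ≡ sumℕ h m
  sumℕ-cong zero    e = refl
  sumℕ-cong (suc m) e =
    cong₂ _+_ (sumℕ-cong m (λ k k≤m → e k (m≤n⇒m≤1+n k≤m))) (e (suc m) ≤-refl)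

  sumℕ-+ : ∀ g h m → sumℕ (λ k → g k + h k) m ≡ sumℕ g m + sumℕ h m
  sumℕ-+ g h zero    = refl
  sumℕ-+ g h (suc m) =
    trans (cong (_+ (g (suc m) + h (suc m))) (sumℕ-+ g h m))
          (+-Props.interchange (sumℕ g m) (sumℕ h m) (g (suc m)) (h (suc m)))

  sumℕ-shift : ∀ g m → sumℕ g (suc m) ≡ g 1 + sumℕ (λ k → g (suc k)) m
  sumℕ-shift g zero    = +-comm 0 (g 1)
  sumℕ-shift g (suc m) =
    trans (cong (_+ g (suc (suc m))) (sumℕ-shift g m)) (+-assoc (g 1) _ _)

  sumℕ-pascal : ∀ n (c P S : ℕ → ℕ) → P 0 ≡ 0 → S (suc n) ≡ 0 →
    (∀ k → k ≤ n → c (suc k) ≡ P k + S (suc k)) →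
    sumℕ c (suc n) ≡ sumℕ (λ k → P k + S k) n
  sumℕ-pascal n c P S P₀≡0 Sₙ₊₁≡0 step = begin
    sumℕ c (suc n)
      ≡⟨ sumℕ-shift c n ⟩
    c 1 + sumℕ (λ k → c (suc k)) n
      ≡⟨ cong₂ _+_ (step 0 z≤n) (sumℕ-cong n step) ⟩
    (P 0 + S 1) + sumℕ (λ k → P k + S (suc k)) n
      ≡⟨ cong₂ (λ p q → (p + S 1) + q) P₀≡0 (sumℕ-+ P (λ k → S (suc k)) n) ⟩
    S 1 + (sumℕ P n + sumℕ (λ k → S (suc k)) n)
      ≡⟨ +-Props.x∙yz≈y∙xz (S 1) (sumℕ P n) _ ⟩
    sumℕ P n + (S 1 + sumℕ (λ k → S (suc k)) n)
      ≡⟨ cong (sumℕ P n +_) (sym (sumℕ-shift S n)) ⟩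
    sumℕ P n + (sumℕ S n + S (suc n))
      ≡⟨ cong (λ s → sumℕ P n + (sumℕ S n + s)) Sₙ₊₁≡0 ⟩
    sumℕ P n + (sumℕ S n + 0)
      ≡⟨ cong (sumℕ P n +_) (+-identityʳ (sumℕ S n)) ⟩
    sumℕ P n + sumℕ S n
      ≡⟨ sym (sumℕ-+ P S n) ⟩
    sumℕ (λ k → P k + S k) n ∎
    where open ≡-Reasoning

  Σᶜ-cong : ∀ {g h} m → (∀ k → g k ≗ h k) → Σᶜ g m ≗ Σᶜ h m
  Σᶜ-cong m e i = sumℕ-cong m (λ k _ → e k i)

  linear-Σ : ∀ {L} → Linear L → ∀ g m → L (Σᶜ g m) ≗ Σᶜ (λ k → L (g k)) m
  linear-Σ linL g zero    i = Linear.homogeneous linL 0 (Σᶜ g zero) i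
  linear-Σ {L} linL g (suc m) i =
    trans (Linear.additive linL (Σᶜ g m) (g (suc m)) i)
          (cong (_+ L (g (suc m)) i) (linear-Σ linL g m i))

  one : Coeffs
  one zero    = 1
  one (suc i) = 0

  mono : ℕ → Coeffs
  mono zero    = one
  mono (suc a) = y· mono a

  basis : ℕ → ℕ → Coeffs
  basis a zero    = mono a
  basis a (suc b) = w· basis a b

  θ-mono : ∀ a → θ (mono a) ≗ a ⊙ mono a
  θ-mono zero    zero    = refl
  θ-mono zero    (suc i) = *-zeroʳ (suc i)
  θ-mono (suc a) zero    = sym (*-zeroʳ (suc a))
  θ-mono (suc a) (suc i) = cong (mono a i +_) (θ-mono a i)

  θ-w· : ∀ f → θ (w· f) ≗ w· θ f ⊕ 2 ⊙ y²· f
  θ-w· f zero          = refl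
  θ-w· f (suc zero)    = lemma (f 1)
    where
    lemma : ∀ x → 1 * (x + 0) ≡ (1 * x + 0) + 2 * 0
    lemma = solve-∀
  θ-w· f (suc (suc j)) = lemma j (f (2 + j)) (f j)
    where
    lemma : ∀ j x z → (2 + j) * (x + z) ≡ ((2 + j) * x + j * z) + 2 * z
    lemma = solve-∀

  y·-w· : ∀ f → y· (w· f) ≗ w· (y· f)
  y·-w· f zero    = refl
  y·-w· f (suc i) = refl

  y²·-w· : ∀ f → y²· (w· f) ≗ w· (y²· f)
  y²·-w· f i = trans (Linear.resp linear-y· (y·-w· f) i) (y·-w· (y· f) i)

  y²·-basis : ∀ a b → y²· basis a b ≗ basis (2 + a) b
  y²·-basis a zero    i = refl
  y²·-basis a (suc b) i =
    trans (y²·-w· (basis a b) i) (Linear.resp linear-w· (y²·-basis a b) i)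

  Dᴿ-basis : ∀ a b →
    Dᴿ (basis a b) ≗ a ⊙ basis a (suc b) ⊕ (2 * b) ⊙ basis (2 + a) b
  Dᴿ-basis a zero = begin
    w· θ (mono a)                        ≈⟨ W.resp (θ-mono a) ⟩
    w· (a ⊙ mono a)                      ≈⟨ W.homogeneous a (mono a) ⟩
    a ⊙ basis a 1                        ≈⟨ (λ i → sym (+-identityʳ _)) ⟩
    a ⊙ basis a 1 ⊕ 0 ⊙ basis (2 + a) 0  ∎
    where
    open ≗-Reasoning
    module W = Linear linear-w·
  Dᴿ-basis a (suc b) = begin
    w· θ (w· B)
      ≈⟨ W.resp (θ-w· B) ⟩
    w· (Dᴿ B ⊕ 2 ⊙ y²· B)
      ≈⟨ W.additive (Dᴿ B) (2 ⊙ y²· B) ⟩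
    w· Dᴿ B ⊕ w· (2 ⊙ y²· B)
      ≈⟨ ⊕-cong (W.resp (Dᴿ-basis a b)) (W.homogeneous 2 (y²· B)) ⟩
    w· (a ⊙ basis a (suc b) ⊕ (2 * b) ⊙ B′) ⊕ 2 ⊙ w· y²· B
      ≈⟨ ⊕-cong (linear-comb linear-w· a _ (2 * b) B′) (⊙-cong 2 (W.resp (y²·-basis a b))) ⟩
    a ⊙ basis a (2 + b) ⊕ (2 * b) ⊙ w· B′ ⊕ 2 ⊙ w· B′
      ≈⟨ (λ i → lemma a b (basis a (2 + b) i) ((w· B′) i)) ⟩
    a ⊙ basis a (2 + b) ⊕ (2 * suc b) ⊙ w· B′ ∎
    where
    open ≗-Reasoning
    module W = Linear linear-w·
    B  = basis a b
    B′ = basis (2 + a) b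
    lemma : ∀ a b x z → (a * x + 2 * b * z) + 2 * z ≡ a * x + 2 * suc b * z
    lemma = solve-∀

  Dᵀ-basis : ∀ a b →
    Dᵀ (basis a b) ≗ suc (2 * b) ⊙ basis (2 + a) b ⊕ a ⊙ basis a (suc b)
  Dᵀ-basis a b i = trans (cong₂ _+_ (y²·-basis a b i) (Dᴿ-basis a b i))
                         (lemma a b (basis (2 + a) b i) (basis a (suc b) i))
    where
    lemma : ∀ a b z x → z + (a * x + 2 * b * z) ≡ suc (2 * b) * z + a * x
    lemma = solve-∀

  N-zero : ∀ n → N n 0 ≡ 0
  N-zero zero          = refl
  N-zero (suc zero)    = refl
  N-zero (suc (suc n)) = refl

  N-vanishes : ∀ n k → n < k → N n k ≡ 0
  N-vanishes zero          k             _         = refl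
  N-vanishes (suc zero)    (suc zero)    (s≤s ())
  N-vanishes (suc zero)    (suc (suc k)) _         = refl
  N-vanishes (suc (suc n)) (suc k)       (s≤s n<k) =
    cong₂ _+_ (trans (cong (2 * suc k *_) (N-vanishes (suc n) (suc k) (m≤n⇒m≤1+n n<k)))
                     (*-zeroʳ (2 * suc k)))
              (trans (cong (c *_) (N-vanishes (suc n) k n<k)) (*-zeroʳ c))
    where c = 2 * suc n + 3 ∸ 2 * suc k

  N-zero-* : ∀ n x → N n 0 * x ≡ 0
  N-zero-* n x = cong (_* x) (N-zero n)

  N-vanishes-* : ∀ n k → n < k → ∀ x → N n k * x ≡ 0
  N-vanishes-* n k n<k x = cong (_* x) (N-vanishes n k n<k)

  N-supported : ∀ n k {x y} → (k ≤ n → x ≡ y) → N n k * x ≡ N n k * y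
  N-supported n k {x} {y} x≡y with k ≤? n
  ... | yes k≤n = cong (N n k *_) (x≡y k≤n)
  ... | no  k≰n = trans (N-vanishes-* n k n<k x) (sym (N-vanishes-* n k n<k y))
    where n<k = ≰⇒> k≰n

  -- odd n k = 2(n-k)+1: the weight in the recurrence and the y-exponent of R's closed form.
  odd : ℕ → ℕ → ℕ
  odd n k = suc (2 * (n ∸ k))

  ∸-suc : ∀ {n k} → suc k ≤ n → n ∸ k ≡ suc (n ∸ suc k)
  ∸-suc = +-∸-assoc 1

  odd-suc : ∀ {n k} → suc k ≤ n → 2 + odd n (suc k) ≡ odd n k
  odd-suc {n} {k} k<n =
    sym (cong suc (trans (cong (2 *_) (∸-suc k<n)) (*-suc 2 (n ∸ suc k))))

  weight≡odd : ∀ n k → k ≤ n → 2 * n + 3 ∸ 2 * suc k ≡ odd n k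
  weight≡odd n k k≤n = begin
    2 * n + 3 ∸ 2 * suc k  ≡⟨ cong₂ _∸_ (+-comm (2 * n) 3) (*-suc 2 k) ⟩
    suc (2 * n) ∸ 2 * k    ≡⟨ +-∸-assoc 1 (*-monoʳ-≤ 2 k≤n) ⟩
    suc (2 * n ∸ 2 * k)    ≡⟨ cong suc (sym (*-distribˡ-∸ 2 n k)) ⟩
    odd n k                ∎
    where open ≡-Reasoning

  N-step : ∀ m k {x x′} → (suc k ≤ suc m → x′ ≡ x) →
    N (suc (suc m)) (suc k) * x
      ≡ N (suc m) k * (odd (suc m) k * x) + N (suc m) (suc k) * (2 * suc k * x′)
  N-step m k {x} {x′} x′≡x = begin
    N (suc n) (suc k) * x
      ≡⟨ cong (λ c → (2 * suc k * N₁ + c) * x) weight ⟩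
    (2 * suc k * N₁ + odd n k * N₀) * x
      ≡⟨ lemma (2 * suc k) N₁ (odd n k) N₀ x ⟩
    N₀ * (odd n k * x) + N₁ * (2 * suc k * x)
      ≡⟨ cong (N₀ * (odd n k * x) +_) (N-supported n (suc k) (cong (2 * suc k *_) ∘ x≡x′)) ⟩
    N₀ * (odd n k * x) + N₁ * (2 * suc k * x′) ∎
    where
    open ≡-Reasoning
    n  = suc m
    N₀ = N n k
    N₁ = N n (suc k)
    x≡x′ : suc k ≤ n → x ≡ x′
    x≡x′ k<n = sym (x′≡x k<n)
    weight : (2 * n + 3 ∸ 2 * suc k) * N₀ ≡ odd n k * N₀
    weight = trans (*-comm _ N₀) (trans (N-supported n k (weight≡odd n k)) (*-comm N₀ _))
    lemma : ∀ s a o b x → (s * a + o * b) * x ≡ b * (o * x) + a * (s * x)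
    lemma = solve-∀

  closedForm : ℕ → (ℕ → ℕ) → (ℕ → ℕ) → Coeffs
  closedForm n e f = Σᶜ (λ k → N n k ⊙ basis (e k) (f k)) n

  Rᶜ : ℕ → Coeffs
  Rᶜ n = closedForm n (odd n) id

  Tᶜ : ℕ → Coeffs
  Tᶜ n = closedForm n (2 *_) (n ∸_)

  linear-closedForm : ∀ {L} → Linear L → ∀ n e f →
    L (closedForm n e f) ≗ Σᶜ (λ k → N n k ⊙ L (basis (e k) (f k))) n
  linear-closedForm linL n e f i =
    trans (linear-Σ linL _ n i)
          (Σᶜ-cong n (λ k → Linear.homogeneous linL (N n k) (basis (e k) (f k))) i)

  -- Dᴿ maps the closed form of R_n to that of R_{n+1} (n ≥ 1): the two terms of
  -- Dᴿ-basis recombine through the recurrence of N.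
  Rᶜ-step : ∀ m → Dᴿ (Rᶜ (suc m)) ≗ Rᶜ (suc (suc m))
  Rᶜ-step m i = begin
    Dᴿ (Rᶜ n) i
      ≡⟨ linear-closedForm linear-Dᴿ n (odd n) id i ⟩
    sumℕ (λ k → N n k * Dᴿ (basis (odd n k) k) i) n
      ≡⟨ sumℕ-cong n (λ k _ → trans (cong (N n k *_) (Dᴿ-basis (odd n k) k i))
                                     (*-distribˡ-+ (N n k) _ _)) ⟩
    sumℕ (λ k → P k + S k) n
      ≡⟨ sym (sumℕ-pascal n c P S (N-zero-* n _) (N-vanishes-* n (suc n) ≤-refl _) recurrence) ⟩
    Rᶜ (suc n) i ∎
    where
    open ≡-Reasoning
    n = suc m
    c P S : ℕ → ℕ
    c k = N (suc n) k * basis (odd (suc n) k) k i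
    P k = N n k * (odd n k * basis (odd n k) (suc k) i)
    S k = N n k * (2 * k * basis (2 + odd n k) k i)
    recurrence : ∀ k → k ≤ n → c (suc k) ≡ P k + S (suc k)
    recurrence k _ = N-step m k (λ k<n → cong (λ a → basis a (suc k) i) (odd-suc k<n))

  Tᶜ-step : ∀ m → Dᵀ (Tᶜ (suc m)) ≗ Tᶜ (suc (suc m))
  Tᶜ-step m i = begin
    Dᵀ (Tᶜ n) i
      ≡⟨ linear-closedForm linear-Dᵀ n (2 *_) (n ∸_) i ⟩
    sumℕ (λ k → N n k * Dᵀ (basis (2 * k) (n ∸ k)) i) n
      ≡⟨ sumℕ-cong n (λ k _ → trans (cong (N n k *_) (Dᵀ-basis (2 * k) (n ∸ k) i))
                                     (*-distribˡ-+ (N n k) _ _)) ⟩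
    sumℕ (λ k → P k + S k) n
      ≡⟨ sym (sumℕ-pascal n c P S (N-zero-* n _) (N-vanishes-* n (suc n) ≤-refl _) recurrence) ⟩
    Tᶜ (suc n) i ∎
    where
    open ≡-Reasoning
    n = suc m
    c P S : ℕ → ℕ
    c k = N (suc n) k * basis (2 * k) (suc n ∸ k) i
    P k = N n k * (odd n k * basis (2 + 2 * k) (n ∸ k) i)
    S k = N n k * (2 * k * basis (2 * k) (suc (n ∸ k)) i)
    recurrence : ∀ k → k ≤ n → c (suc k) ≡ P k + S (suc k)
    recurrence k _ =
      trans (cong (λ a → N (suc n) (suc k) * basis a (n ∸ k) i) (*-suc 2 k))
            (N-step m k (λ k<n → cong₂ (λ a b → basis a b i) (*-suc 2 k) (sym (∸-suc k<n))))

  coeff-padd : ∀ p q → coeff (padd p q) ≗ coeff p ⊕ coeff q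
  coeff-padd []      q       i       = refl
  coeff-padd (a ∷ p) []      i       = sym (+-identityʳ _)
  coeff-padd (a ∷ p) (b ∷ q) zero    = refl
  coeff-padd (a ∷ p) (b ∷ q) (suc i) = coeff-padd p q i

  coeff-pscale : ∀ c p → coeff (pscale c p) ≗ c ⊙ coeff p
  coeff-pscale c []      i       = sym (*-zeroʳ c)
  coeff-pscale c (a ∷ p) zero    = refl
  coeff-pscale c (a ∷ p) (suc i) = coeff-pscale c p i

  coeff-pmul-∷ : ∀ a p q → coeff (pmul (a ∷ p) q) ≗ a ⊙ coeff q ⊕ y· coeff (pmul p q)
  coeff-pmul-∷ a p q zero    =
    trans (coeff-padd (pscale a q) _ 0) (cong (_+ 0) (coeff-pscale a q 0))
  coeff-pmul-∷ a p q (suc i) =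
    trans (coeff-padd (pscale a q) _ (suc i)) (cong (_+ coeff (pmul p q) i) (coeff-pscale a q (suc i)))

  coeff-pmul-1 : ∀ q → coeff (pmul (1 ∷ []) q) ≗ coeff q
  coeff-pmul-1 q zero    = trans (coeff-pmul-∷ 1 [] q 0) (trans (+-identityʳ _) (*-identityˡ _))
  coeff-pmul-1 q (suc i) = trans (coeff-pmul-∷ 1 [] q (suc i)) (trans (+-identityʳ _) (*-identityˡ _))

  coeff-pmul-y : ∀ q → coeff (pmul (0 ∷ 1 ∷ []) q) ≗ y· coeff q
  coeff-pmul-y q i =
    trans (coeff-pmul-∷ 0 (1 ∷ []) q i) (Linear.resp linear-y· (coeff-pmul-1 q) i)

  coeff-y² : ∀ q → coeff (pmul y² q) ≗ y²· coeff q
  coeff-y² q i =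
    trans (coeff-pmul-∷ 0 (0 ∷ 1 ∷ []) q i) (Linear.resp linear-y· (coeff-pmul-y q) i)

  coeff-derivFrom : ∀ k p i → coeff (derivFrom k p) i ≡ (k + i) * coeff p i
  coeff-derivFrom k []      i       = sym (*-zeroʳ (k + i))
  coeff-derivFrom k (a ∷ p) zero    = cong (_* a) (sym (+-identityʳ k))
  coeff-derivFrom k (a ∷ p) (suc i) =
    trans (coeff-derivFrom (suc k) p i) (cong (_* coeff p i) (sym (+-suc k i)))

  y·-deriv : ∀ p → y· coeff (deriv p) ≗ θ (coeff p)
  y·-deriv p       zero    = refl
  y·-deriv []      (suc i) = sym (*-zeroʳ (suc i))
  y·-deriv (a ∷ p) (suc i) = coeff-derivFrom 1 p i

  coeff-Dᴿ : ∀ p → coeff (pmul y+y³ (deriv p)) ≗ Dᴿ (coeff p)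
  coeff-Dᴿ p = begin
    coeff (pmul y+y³ p′)
      ≈⟨ coeff-pmul-∷ 0 (1 ∷ 0 ∷ 1 ∷ []) p′ ⟩
    y· coeff (pmul (1 ∷ 0 ∷ 1 ∷ []) p′)
      ≈⟨ Y.resp (coeff-pmul-∷ 1 (0 ∷ 1 ∷ []) p′) ⟩
    y· (1 ⊙ coeff p′ ⊕ y· coeff (pmul (0 ∷ 1 ∷ []) p′))
      ≈⟨ Y.resp (⊕-cong (λ i → *-identityˡ _) (Y.resp (coeff-pmul-y p′))) ⟩
    y· w· coeff p′
      ≈⟨ y·-w· (coeff p′) ⟩
    w· y· coeff p′
      ≈⟨ Linear.resp linear-w· (y·-deriv p) ⟩
    Dᴿ (coeff p) ∎
    where
    open ≗-Reasoning
    module Y = Linear linear-y·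
    p′ = deriv p

  coeff-Dᵀ : ∀ p → coeff (padd (pmul y² p) (pmul y+y³ (deriv p))) ≗ Dᵀ (coeff p)
  coeff-Dᵀ p i = trans (coeff-padd (pmul y² p) _ i) (⊕-cong (coeff-y² p) (coeff-Dᴿ p) i)

  R-closedForm : ∀ m → coeff (R (suc m)) ≗ Rᶜ (suc m)
  R-closedForm zero    zero                      = refl
  R-closedForm zero    (suc zero)                = refl
  R-closedForm zero    (suc (suc zero))          = refl
  R-closedForm zero    (suc (suc (suc zero)))    = refl
  R-closedForm zero    (suc (suc (suc (suc i)))) = refl
  R-closedForm (suc m) i = trans (coeff-Dᴿ (R (suc m)) i)
    (trans (Linear.resp linear-Dᴿ (R-closedForm m) i) (Rᶜ-step m i))

  T-closedForm : ∀ m → coeff (T (suc m)) ≗ Tᶜ (suc m)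
  T-closedForm zero    zero                      = refl
  T-closedForm zero    (suc zero)                = refl
  T-closedForm zero    (suc (suc zero))          = refl
  T-closedForm zero    (suc (suc (suc zero)))    = refl
  T-closedForm zero    (suc (suc (suc (suc i)))) = refl
  T-closedForm (suc m) i = trans (coeff-Dᵀ (T (suc m)) i)
    (trans (Linear.resp linear-Dᵀ (T-closedForm m) i) (Tᶜ-step m i))

  monoPoly : ℕ → Poly
  monoPoly zero    = 1 ∷ []
  monoPoly (suc a) = 0 ∷ monoPoly a

  basisPoly : ℕ → ℕ → Poly
  basisPoly a zero    = monoPoly a
  basisPoly a (suc b) = padd (basisPoly a b) (0 ∷ 0 ∷ basisPoly a b)

  sumPoly : (ℕ → Poly) → ℕ → Poly
  sumPoly g zero    = []
  sumPoly g (suc m) = padd (sumPoly g m) (g (suc m))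

  closedPoly : ℕ → (ℕ → ℕ) → (ℕ → ℕ) → Poly
  closedPoly n e f = sumPoly (λ k → pscale (N n k) (basisPoly (e k) (f k))) n

  coeff-monoPoly : ∀ a → coeff (monoPoly a) ≗ mono a
  coeff-monoPoly zero    zero    = refl
  coeff-monoPoly zero    (suc i) = refl
  coeff-monoPoly (suc a) zero    = refl
  coeff-monoPoly (suc a) (suc i) = coeff-monoPoly a i

  coeff-0∷0∷ : ∀ p → coeff (0 ∷ 0 ∷ p) ≗ y²· coeff p
  coeff-0∷0∷ p zero          = refl
  coeff-0∷0∷ p (suc zero)    = refl
  coeff-0∷0∷ p (suc (suc i)) = refl

  coeff-basisPoly : ∀ a b → coeff (basisPoly a b) ≗ basis a b
  coeff-basisPoly a zero    i = coeff-monoPoly a i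
  coeff-basisPoly a (suc b) i = trans (coeff-padd p (0 ∷ 0 ∷ p) i)
    (⊕-cong (coeff-basisPoly a b)
            (λ j → trans (coeff-0∷0∷ p j) (Linear.resp linear-y²· (coeff-basisPoly a b) j)) i)
    where p = basisPoly a b

  coeff-sumPoly : ∀ g m → coeff (sumPoly g m) ≗ Σᶜ (λ k → coeff (g k)) m
  coeff-sumPoly g zero    i = refl
  coeff-sumPoly g (suc m) i = trans (coeff-padd (sumPoly g m) (g (suc m)) i)
    (cong (_+ coeff (g (suc m)) i) (coeff-sumPoly g m i))

  coeff-closedPoly : ∀ n e f → coeff (closedPoly n e f) ≗ closedForm n e f
  coeff-closedPoly n e f i = trans (coeff-sumPoly _ n i) (Σᶜ-cong n coeff-term i)
    where
    coeff-term : ∀ k → coeff (pscale (N n k) (basisPoly (e k) (f k))) ≗ N n k ⊙ basis (e k) (f k)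
    coeff-term k j = trans (coeff-pscale (N n k) (basisPoly (e k) (f k)) j)
                           (cong (N n k *_) (coeff-basisPoly (e k) (f k) j))

  R≗closedPoly : ∀ m → coeff (R (suc m)) ≗ coeff (closedPoly (suc m) (odd (suc m)) id)
  R≗closedPoly m i =
    trans (R-closedForm m i) (sym (coeff-closedPoly (suc m) (odd (suc m)) id i))

  T≗closedPoly : ∀ m → coeff (T (suc m)) ≗ coeff (closedPoly (suc m) (2 *_) (suc m ∸_))
  T≗closedPoly m i =
    trans (T-closedForm m i) (sym (coeff-closedPoly (suc m) (2 *_) (suc m ∸_) i))

open Coefficients
  using (coeff; odd; monoPoly; basisPoly; sumPoly; closedPoly; R≗closedPoly; T≗closedPoly)

open import Data.Rational using (ℚ; 1ℚ; _+_; _*_; _÷_; NonZero)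
open import Data.Rational using (mkℚ; 0ℚ; 1/_)
open import Data.Nat using (zero; suc)
open import Data.List using ([]; _∷_)
open import Data.Nat.Coprimality using (1-coprimeTo) renaming (sym to coprime-sym)
open import Data.Rational.Solver using (module +-*-Solver)
open +-*-Solver using (solve; _:+_; _:*_; _:=_; con)
import Data.Integer as ℤ
import Data.Integer.Properties as ℤP
import Data.Nat.Properties as ℕP
import Data.Rational.Properties as ℚP
open ≡-Reasoning

fromℕ-mkℚ : ∀ c → fromℕ c ≡ mkℚ (ℤ.+ c) 0 (coprime-sym (1-coprimeTo c))
fromℕ-mkℚ c = ℚP.normalize-coprime (coprime-sym (1-coprimeTo c))

fromℕ-+ : ∀ a b → fromℕ (a ℕ.+ b) ≡ fromℕ a + fromℕ b
fromℕ-+ a b rewrite fromℕ-mkℚ a | fromℕ-mkℚ b =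
  cong (λ z → Data.Rational._/_ z 1)
       (cong₂ ℤ._+_ (sym (ℤP.*-identityʳ (ℤ.+ a))) (sym (ℤP.*-identityʳ (ℤ.+ b))))

fromℕ-* : ∀ a b → fromℕ (a ℕ.* b) ≡ fromℕ a * fromℕ b
fromℕ-* a b = trans (cong (λ z → Data.Rational._/_ z 1) (ℤP.pos-* a b))
                    (cong₂ _*_ (sym (fromℕ-mkℚ a)) (sym (fromℕ-mkℚ b)))

eval-padd : ∀ p q y → eval (padd p q) y ≡ eval p y + eval q y
eval-padd []      q       y = sym (ℚP.+-identityˡ _)
eval-padd (a ∷ p) []      y = sym (ℚP.+-identityʳ _)
eval-padd (a ∷ p) (b ∷ q) y = begin
  fromℕ (a ℕ.+ b) + y * eval (padd p q) y
    ≡⟨ cong₂ (λ u v → u + y * v) (fromℕ-+ a b) (eval-padd p q y) ⟩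
  (fromℕ a + fromℕ b) + y * (eval p y + eval q y)
    ≡⟨ solve 5 (λ a b y p q → (a :+ b) :+ y :* (p :+ q) := (a :+ y :* p) :+ (b :+ y :* q))
             refl (fromℕ a) (fromℕ b) y (eval p y) (eval q y) ⟩
  (fromℕ a + y * eval p y) + (fromℕ b + y * eval q y) ∎

eval-pscale : ∀ c p y → eval (pscale c p) y ≡ fromℕ c * eval p y
eval-pscale c []      y = sym (ℚP.*-zeroʳ (fromℕ c))
eval-pscale c (a ∷ p) y = begin
  fromℕ (c ℕ.* a) + y * eval (pscale c p) y
    ≡⟨ cong₂ (λ u v → u + y * v) (fromℕ-* c a) (eval-pscale c p y) ⟩
  fromℕ c * fromℕ a + y * (fromℕ c * eval p y)
    ≡⟨ solve 4 (λ c a y p → c :* a :+ y :* (c :* p) := c :* (a :+ y :* p))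
             refl (fromℕ c) (fromℕ a) y (eval p y) ⟩
  fromℕ c * (fromℕ a + y * eval p y) ∎

eval-null : ∀ p y → coeff p ≗ (λ _ → 0) → eval p y ≡ 0ℚ
eval-null []      y p≗0 = refl
eval-null (a ∷ p) y p≗0 = begin
  fromℕ a + y * eval p y
    ≡⟨ cong₂ (λ c v → fromℕ c + y * v) (p≗0 0) (eval-null p y (p≗0 ∘ suc)) ⟩
  0ℚ + y * 0ℚ
    ≡⟨ trans (ℚP.+-identityˡ _) (ℚP.*-zeroʳ y) ⟩
  0ℚ ∎

eval-resp : ∀ p q y → coeff p ≗ coeff q → eval p y ≡ eval q y
eval-resp []      q       y p≗q = sym (eval-null q y (sym ∘ p≗q))
eval-resp (a ∷ p) []      y p≗q = eval-null (a ∷ p) y p≗q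
eval-resp (a ∷ p) (b ∷ q) y p≗q =
  cong₂ (λ c v → fromℕ c + y * v) (p≗q 0) (eval-resp p q y (p≗q ∘ suc))

^-+ : ∀ x a b → x ^ (a ℕ.+ b) ≡ x ^ a * x ^ b
^-+ x zero    b = sym (ℚP.*-identityˡ _)
^-+ x (suc a) b = trans (cong (x *_) (^-+ x a b)) (sym (ℚP.*-assoc x _ _))

^-* : ∀ x z k → (x * z) ^ k ≡ x ^ k * z ^ k
^-* x z zero    = refl
^-* x z (suc k) = trans (cong ((x * z) *_) (^-* x z k))
  (solve 4 (λ x z p q → (x :* z) :* (p :* q) := (x :* p) :* (z :* q)) refl x z (x ^ k) (z ^ k))

^-double : ∀ x k → x ^ (2 ℕ.* k) ≡ (x * x) ^ k
^-double x zero    = refl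
^-double x (suc k) = begin
  x ^ (2 ℕ.* suc k)        ≡⟨ cong (x ^_) (ℕP.*-suc 2 k) ⟩
  x * (x * x ^ (2 ℕ.* k))  ≡⟨ cong (λ p → x * (x * p)) (^-double x k) ⟩
  x * (x * (x * x) ^ k)    ≡⟨ sym (ℚP.*-assoc x x _) ⟩
  (x * x) * (x * x) ^ k    ∎

^-rescale : ∀ {s w t} n k → s * w ≡ t → k ℕ.≤ n → s ^ n * w ^ k ≡ s ^ (n ℕ.∸ k) * t ^ k
^-rescale {s} {w} {t} n k sw≡t k≤n = begin
  s ^ n * w ^ k                    ≡⟨ cong (λ e → s ^ e * w ^ k) (sym (ℕP.m∸n+n≡m k≤n)) ⟩
  s ^ (n ℕ.∸ k ℕ.+ k) * w ^ k      ≡⟨ cong (_* w ^ k) (^-+ s (n ℕ.∸ k) k) ⟩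
  (s ^ (n ℕ.∸ k) * s ^ k) * w ^ k  ≡⟨ ℚP.*-assoc (s ^ (n ℕ.∸ k)) _ _ ⟩
  s ^ (n ℕ.∸ k) * (s ^ k * w ^ k)  ≡⟨ cong (s ^ (n ℕ.∸ k) *_) (sym (^-* s w k)) ⟩
  s ^ (n ℕ.∸ k) * (s * w) ^ k      ≡⟨ cong (λ z → s ^ (n ℕ.∸ k) * z ^ k) sw≡t ⟩
  s ^ (n ℕ.∸ k) * t ^ k            ∎

*-÷-cancel : ∀ a b .{{_ : NonZero a}} → a * (b ÷ a) ≡ b
*-÷-cancel a b = begin
  a * (b * 1/ a)  ≡⟨ solve 3 (λ a b i → a :* (b :* i) := b :* (a :* i)) refl a b (1/ a) ⟩
  b * (a * 1/ a)  ≡⟨ cong (b *_) (ℚP.*-inverseʳ a) ⟩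
  b * 1ℚ          ≡⟨ ℚP.*-identityʳ b ⟩
  b               ∎

sum1-cong : ∀ {f g} m → (∀ k → k ℕ.≤ m → f k ≡ g k) → sum1 f m ≡ sum1 g m
sum1-cong zero    e = refl
sum1-cong (suc m) e =
  cong₂ _+_ (sum1-cong m (λ k k≤m → e k (ℕP.m≤n⇒m≤1+n k≤m))) (e (suc m) ℕP.≤-refl)

sum1-distrib : ∀ x f m → x * sum1 f m ≡ sum1 (λ k → x * f k) m
sum1-distrib x f zero    = ℚP.*-zeroʳ x
sum1-distrib x f (suc m) = trans (ℚP.*-distribˡ-+ x (sum1 f m) (f (suc m)))
                                 (cong (_+ x * f (suc m)) (sum1-distrib x f m))

factor-Npoly : ∀ n (Y x : ℚ) (G : ℕ → ℚ) → (∀ k → k ℕ.≤ n → Y * x ^ k ≡ G k) →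
  Y * Npoly n x ≡ sum1 (λ k → fromℕ (N n k) * G k) n
factor-Npoly n Y x G Yxᵏ≡G =
  trans (sum1-distrib Y (λ k → fromℕ (N n k) * x ^ k) n) (sum1-cong n term)
  where
  term : ∀ k → k ℕ.≤ n → Y * (fromℕ (N n k) * x ^ k) ≡ fromℕ (N n k) * G k
  term k k≤n = begin
    Y * (fromℕ (N n k) * x ^ k)
      ≡⟨ solve 3 (λ Y c p → Y :* (c :* p) := c :* (Y :* p)) refl Y (fromℕ (N n k)) (x ^ k) ⟩
    fromℕ (N n k) * (Y * x ^ k)
      ≡⟨ cong (fromℕ (N n k) *_) (Yxᵏ≡G k k≤n) ⟩
    fromℕ (N n k) * G k ∎

eval-monoPoly : ∀ a y → eval (monoPoly a) y ≡ y ^ a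
eval-monoPoly zero    y = trans (cong (1ℚ +_) (ℚP.*-zeroʳ y)) (ℚP.+-identityʳ 1ℚ)
eval-monoPoly (suc a) y = trans (ℚP.+-identityˡ _) (cong (y *_) (eval-monoPoly a y))

eval-basisPoly : ∀ a b y → eval (basisPoly a b) y ≡ y ^ a * (1ℚ + y * y) ^ b
eval-basisPoly a zero    y = trans (eval-monoPoly a y) (sym (ℚP.*-identityʳ _))
eval-basisPoly a (suc b) y = begin
  eval (padd p (0 ∷ 0 ∷ p)) y
    ≡⟨ eval-padd p (0 ∷ 0 ∷ p) y ⟩
  v + (0ℚ + y * (0ℚ + y * v))
    ≡⟨ cong (λ e → e + (0ℚ + y * (0ℚ + y * e))) (eval-basisPoly a b y) ⟩
  P * W + (0ℚ + y * (0ℚ + y * (P * W)))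
    ≡⟨ solve 3 (λ y P W → P :* W :+ (con 0ℚ :+ y :* (con 0ℚ :+ y :* (P :* W)))
                           := P :* ((con 1ℚ :+ y :* y) :* W)) refl y P W ⟩
  P * ((1ℚ + y * y) * W) ∎
  where
  p = basisPoly a b
  v = eval p y
  P = y ^ a
  W = (1ℚ + y * y) ^ b

eval-sumPoly : ∀ g m y → eval (sumPoly g m) y ≡ sum1 (λ k → eval (g k) y) m
eval-sumPoly g zero    y = refl
eval-sumPoly g (suc m) y = trans (eval-padd (sumPoly g m) (g (suc m)) y)
                                 (cong (_+ eval (g (suc m)) y) (eval-sumPoly g m y))

eval-closedPoly : ∀ n e f y →
  eval (closedPoly n e f) y ≡ sum1 (λ k → fromℕ (N n k) * (y ^ e k * (1ℚ + y * y) ^ f k)) n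
eval-closedPoly n e f y = trans (eval-sumPoly _ n y) (sum1-cong n eval-term)
  where
  eval-term : ∀ k → k ℕ.≤ n →
    eval (pscale (N n k) (basisPoly (e k) (f k))) y ≡ fromℕ (N n k) * (y ^ e k * (1ℚ + y * y) ^ f k)
  eval-term k _ = trans (eval-pscale (N n k) (basisPoly (e k) (f k)) y)
                        (cong (fromℕ (N n k) *_) (eval-basisPoly (e k) (f k) y))

R-identity : ∀ m (y : ℚ) .{{_ : NonZero y}} →
  eval (R (suc m)) y
    ≡ y ^ (2 ℕ.* suc m ℕ.+ 1) * Npoly (suc m) (_÷_ (1ℚ + y * y) (y * y) {{sq-nonZero y}})
R-identity m y = begin
  eval (R n) y
    ≡⟨ eval-resp (R n) (closedPoly n (odd n) id) y (R≗closedPoly m) ⟩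
  eval (closedPoly n (odd n) id) y
    ≡⟨ eval-closedPoly n (odd n) id y ⟩
  sum1 (λ k → fromℕ (N n k) * (y ^ odd n k * u ^ k)) n
    ≡⟨ sym (factor-Npoly n (y ^ (2 ℕ.* n ℕ.+ 1)) x _ term) ⟩
  y ^ (2 ℕ.* n ℕ.+ 1) * Npoly n x ∎
  where
  n = suc m
  u = 1ℚ + y * y
  x = _÷_ u (y * y) {{sq-nonZero y}}
  -- y^{2n+1} xᵏ = y (y²)ⁿ xᵏ = y (y²)^{n-k} uᵏ, since y² x = u.
  term : ∀ k → k ℕ.≤ n → y ^ (2 ℕ.* n ℕ.+ 1) * x ^ k ≡ y ^ odd n k * u ^ k
  term k k≤n = begin
    y ^ (2 ℕ.* n ℕ.+ 1) * x ^ k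
      ≡⟨ cong (λ e → y ^ e * x ^ k) (ℕP.+-comm (2 ℕ.* n) 1) ⟩
    y * y ^ (2 ℕ.* n) * x ^ k
      ≡⟨ cong (λ p → y * p * x ^ k) (^-double y n) ⟩
    y * (y * y) ^ n * x ^ k
      ≡⟨ ℚP.*-assoc y ((y * y) ^ n) (x ^ k) ⟩
    y * ((y * y) ^ n * x ^ k)
      ≡⟨ cong (y *_) (^-rescale n k (*-÷-cancel (y * y) u {{sq-nonZero y}}) k≤n) ⟩
    y * ((y * y) ^ (n ℕ.∸ k) * u ^ k)
      ≡⟨ sym (ℚP.*-assoc y ((y * y) ^ (n ℕ.∸ k)) (u ^ k)) ⟩
    y * (y * y) ^ (n ℕ.∸ k) * u ^ k
      ≡⟨ cong (λ p → y * p * u ^ k) (sym (^-double y (n ℕ.∸ k))) ⟩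
    y ^ odd n k * u ^ k ∎

T-identity : ∀ m (y : ℚ) →
  eval (T (suc m)) y
    ≡ (1ℚ + y * y) ^ suc m * Npoly (suc m) (_÷_ (y * y) (1ℚ + y * y) {{onePlusSq-nonZero y}})
T-identity m y = begin
  eval (T n) y
    ≡⟨ eval-resp (T n) (closedPoly n (2 ℕ.*_) (n ℕ.∸_)) y (T≗closedPoly m) ⟩
  eval (closedPoly n (2 ℕ.*_) (n ℕ.∸_)) y
    ≡⟨ eval-closedPoly n (2 ℕ.*_) (n ℕ.∸_) y ⟩
  sum1 (λ k → fromℕ (N n k) * (y ^ (2 ℕ.* k) * u ^ (n ℕ.∸ k))) n
    ≡⟨ sym (factor-Npoly n (u ^ n) x _ term) ⟩
  u ^ n * Npoly n x ∎
  where
  n = suc m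
  u = 1ℚ + y * y
  x = _÷_ (y * y) u {{onePlusSq-nonZero y}}
  -- uⁿ xᵏ = u^{n-k} (y²)ᵏ, since u x = y².
  term : ∀ k → k ℕ.≤ n → u ^ n * x ^ k ≡ y ^ (2 ℕ.* k) * u ^ (n ℕ.∸ k)
  term k k≤n = begin
    u ^ n * x ^ k
      ≡⟨ ^-rescale n k (*-÷-cancel u (y * y) {{onePlusSq-nonZero y}}) k≤n ⟩
    u ^ (n ℕ.∸ k) * (y * y) ^ k
      ≡⟨ ℚP.*-comm (u ^ (n ℕ.∸ k)) ((y * y) ^ k) ⟩
    (y * y) ^ k * u ^ (n ℕ.∸ k)
      ≡⟨ cong (_* u ^ (n ℕ.∸ k)) (sym (^-double y k)) ⟩
    y ^ (2 ℕ.* k) * u ^ (n ℕ.∸ k) ∎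

mainTheorem8 : (n : ℕ) → 1 ≤ n →
    ((y : ℚ) → .{{_ : NonZero y}} →
      eval (R n) y ≡ y ^ (2 ℕ.* n ℕ.+ 1) * Npoly n (_÷_ (1ℚ + y * y) (y * y) {{sq-nonZero y}}))
    × ((y : ℚ) →
      eval (T n) y ≡ (1ℚ + y * y) ^ n * Npoly n (_÷_ (y * y) (1ℚ + y * y) {{onePlusSq-nonZero y}}))
mainTheorem8 zero    ()
mainTheorem8 (suc m) _ = (λ y → R-identity m y) , T-identity m
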